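{- For all integers $m\ge 2$ and $n\ge 0$, $$(m+1)^n+1\ge \tau(m)^n+2^n,$$ where $\tau(m)$ denotes the number of positive divisors of $m$. -}

module Defs where

open import Data.Nat using (ℕ; suc)
open import Data.Nat.Divisibility using (_∣?_)
open import Data.List using (List; length; filter; upTo; map)

positivesUpTo : ℕ → List ℕ
positivesUpTo m = map suc (upTo m)

-- τ m = number of positive divisors of m
-- (every positive divisor of m ≥ 1 lies in 1 … m).
τ : ℕ → ℕ
τ m = length (filter (_∣? m) (positivesUpTo m))

-- Since τ m ≤ m, it suffices to show a ^ n + 2 ^ n ≤ (a + 1) ^ n + 1 for every a ≥ 1
-- (for a = 0 the bound is immediate). This goes by induction on n: adding the inequality
-- for n, the inequality 2 ^ n ≤ (a + 1) ^ n, and (a - 1) a ^ n ≤ (a - 1) (a + 1) ^ n gives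
-- a ^ (n + 1) + 2 ^ (n + 1) ≤ (a + 1) ^ (n + 1) + 1.
module Submission where

open import Defs
open import Data.Nat using (ℕ; _+_; _^_; _≤_; _*_; zero; suc; z≤n; s≤s)
open import Data.Nat.Properties
open import Data.Nat.Divisibility using (_∣?_)
open import Data.List using (upTo)
open import Data.List.Properties using (length-filter; length-map; length-upTo)
open import Relation.Binary.PropositionalEquality using (_≡_; refl; subst₂; trans)
open import Data.Nat.Tactic.RingSolver using (solve-∀)

τ≤n : ∀ m → τ m ≤ m
τ≤n m = ≤-trans (length-filter (_∣? m) (positivesUpTo m))
          (≤-reflexive (trans (length-map suc (upTo m)) (length-upTo m)))

[1+a]^k+2^k≤[1+a+1]^k+1 : ∀ a k → suc a ^ k + 2 ^ k ≤ (suc a + 1) ^ k + 1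
[1+a]^k+2^k≤[1+a+1]^k+1 a zero    = ≤-refl
[1+a]^k+2^k≤[1+a+1]^k+1 a (suc k) =
  subst₂ _≤_ (lhs-split a (suc a ^ k) (2 ^ k)) (rhs-split a ((suc a + 1) ^ k)) summed
  where
  lhs-split : ∀ c x y → (x + y) + y + c * x ≡ (1 + c) * x + 2 * y
  lhs-split = solve-∀
  rhs-split : ∀ c z → (z + 1) + z + c * z ≡ (1 + c + 1) * z + 1
  rhs-split = solve-∀
  summed : (suc a ^ k + 2 ^ k) + 2 ^ k + a * suc a ^ k
         ≤ ((suc a + 1) ^ k + 1) + (suc a + 1) ^ k + a * (suc a + 1) ^ k
  summed = +-mono-≤ (+-mono-≤ ([1+a]^k+2^k≤[1+a+1]^k+1 a k) (^-monoˡ-≤ k (+-monoˡ-≤ 1 (s≤s z≤n))))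
                    (*-monoʳ-≤ a (^-monoˡ-≤ k (m≤m+n (suc a) 1)))

0^k≤1 : ∀ k → 0 ^ k ≤ 1
0^k≤1 zero    = ≤-refl
0^k≤1 (suc k) = z≤n

a≤b⇒a^k+2^k≤[b+1]^k+1 : ∀ {a b} k → 1 ≤ b → a ≤ b → a ^ k + 2 ^ k ≤ (b + 1) ^ k + 1
a≤b⇒a^k+2^k≤[b+1]^k+1 {zero}  {b} k 1≤b _ =
  subst₂ _≤_ refl (+-comm 1 ((b + 1) ^ k)) (+-mono-≤ (0^k≤1 k) (^-monoˡ-≤ k (+-monoˡ-≤ 1 1≤b)))
a≤b⇒a^k+2^k≤[b+1]^k+1 {suc a} k _ a≤b =
  ≤-trans ([1+a]^k+2^k≤[1+a+1]^k+1 a k) (+-monoˡ-≤ 1 (^-monoˡ-≤ k (+-monoˡ-≤ 1 a≤b)))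

proposition2p5 : ∀ (m n : ℕ) → 2 ≤ m → τ m ^ n + 2 ^ n ≤ (m + 1) ^ n + 1
proposition2p5 m n 2≤m = a≤b⇒a^k+2^k≤[b+1]^k+1 n (≤-trans (n≤1+n 1) 2≤m) (τ≤n m)
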